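{- For every agent $i$ and every formula $\phi$ of $\mathbf{LUT}$, $\vDash\neg K_iU_i\phi$.
   Context: Let $\mathbf{P}$ be a countably infinite set of propositional variables and $\mathbf{I}$ a finite set of agents. The language $\mathbf{LUT}$ is given by $\phi::= p\mid\neg\phi\mid(\phi\land\phi)\mid K_i\phi\mid[\phi]\phi\mid U_i\phi$ ($p\in\mathbf{P}$, $i\in\mathbf{I}$); $\mathbf{EL}$ is the fragment without $[\cdot]$ and $U_i$. A model is $\mathcal{M}=\langle S,\{R_i\}_{i\in\mathbf{I}},V\rangle$ with $S\neq\emptyset$, each $R_i$ a reflexive relation on $S$, $V:\mathbf{P}\to2^S$. Truth: $p$ true at $s$ iff $s\in V(p)$; Boolean clauses as usual; $\mathcal{M},s\vDash K_i\phi$ iff $\phi$ holds at all $t$ with $sR_it$; $\mathcal{M},s\vDash[\psi]\phi$ iff ($\mathcal{M},s\vDash\psi$ implies $\mathcal{M}|_\psi,s\vDash\phi$), with $\mathcal{M}|_\psi$ the restriction of $\mathcal{M}$ to the states where $\psi$ is true; $\mathcal{M},s\vDash U_i\phi$ iff $\mathcal{M},s\vDash\phi$ and for all $\psi\in\mathbf{EL}$, $\mathcal{M},s\vDash[\psi]\neg K_i\phi$. $\vDash\phi$ means $\phi$ is true at every state of every model. -}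

module Defs where

open import Data.Nat using (ℕ)
open import Data.Fin using (Fin)
open import Data.Product using (_×_)
open import Data.Empty using (⊥)
open import Data.Unit using (⊤)

Prop : Set
Prop = ℕ

module _ (n : ℕ) where

  data EL : Set where
    atomᴱ : Prop → EL
    ¬ᴱ_   : EL → EL
    _∧ᴱ_  : EL → EL → EL
    Kᴱ    : Fin n → EL → EL

  data LUT : Set where
    atom : Prop → LUT
    ¬'_  : LUT → LUT
    _∧'_ : LUT → LUT → LUT
    K    : Fin n → LUT → LUT
    [_]_ : LUT → LUT → LUT
    U    : Fin n → LUT → LUT

  record Model : Set₁ where
    field
      S     : Set
      R     : Fin n → S → S → Set
      R-refl : ∀ i s → R i s s
      V     : Prop → S → Set

  -- M|_ψ is represented by shrinking D; the relations
  -- and valuation of the restriction are the restrictions to D.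
  record SubModel : Set₁ where
    field
      M : Model
      D : Model.S M → Set
    open Model M public

  open SubModel

  satEL : (N : SubModel) → EL → S N → Set
  satEL N (atomᴱ p) s = V N p s
  satEL N (¬ᴱ φ) s = satEL N φ s → ⊥
  satEL N (φ ∧ᴱ ψ) s = satEL N φ s × satEL N ψ s
  satEL N (Kᴱ i φ) s = ∀ t → D N t → R N i s t → satEL N φ t

  restrict : (N : SubModel) → (S N → Set) → SubModel
  restrict N P = record { M = M N ; D = λ t → D N t × P t }

  sat : (N : SubModel) → LUT → S N → Set
  sat N (atom p) s = V N p s
  sat N (¬' φ) s = sat N φ s → ⊥
  sat N (φ ∧' ψ) s = sat N φ s × sat N ψ s
  sat N (K i φ) s = ∀ t → D N t → R N i s t → sat N φ t
  sat N ([ ψ ] φ) s = sat N ψ s → sat (restrict N (λ t → sat N ψ t)) φ s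
  -- M,s ⊨ U_i φ iff M,s ⊨ φ and for all ψ ∈ EL, M,s ⊨ [ψ]¬K_i φ
  -- (the clause for [ψ]¬K_i φ unfolded, with ψ read via the EL semantics)
  sat N (U i φ) s =
    sat N φ s ×
    ((ψ : EL) → satEL N ψ s →
      let N' = restrict N (λ t → satEL N ψ t) in
      (∀ t → D N' t → R N' i s t → sat N' φ t) → ⊥)

  _,_⊨_ : (M : Model) → Model.S M → LUT → Set
  M , s ⊨ φ = sat (record { M = M ; D = λ _ → ⊤ }) φ s

  ⊨_ : LUT → Set₁
  ⊨ φ = (M : Model) (s : Model.S M) → M , s ⊨ φ

{-# OPTIONS --safe #-}
-- Truth is invariant under replacing the domain of a (restricted) model by a
-- pointwise equivalent one.  Announcing a tautology therefore leaves the model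
-- unchanged, so U_i φ, which demands ¬K_i φ after every announcement, implies
-- ¬K_i φ outright.  If K_i U_i φ held at s, reflexivity would give U_i φ at s,
-- hence ¬K_i φ at s, while K_i U_i φ also yields K_i φ at s since U_i φ implies φ.
module Submission where

open import Defs
open import Data.Nat using (ℕ)
open import Data.Fin using (Fin)
open import Data.Product using (_×_; _,_; proj₁)
open import Data.Product.Function.NonDependent.Propositional using (_×-⇔_)
open import Data.Unit using (⊤; tt)
open import Function.Bundles using (_⇔_; mk⇔; Equivalence)
open import Function.Construct.Identity using (⇔-id)
open import Function.Related.TypeIsomorphisms using (→-cong-⇔; ¬-cong-⇔)
open import Relation.Nullary using (¬_)

open Equivalence

Π-cong-⇔ : {A : Set} {B C : A → Set} → (∀ x → B x ⇔ C x) → ((x : A) → B x) ⇔ ((x : A) → C x)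
Π-cong-⇔ B⇔C = mk⇔ (λ f x → to (B⇔C x) (f x)) (λ g x → from (B⇔C x) (g x))

⊤ᴱ : {n : ℕ} → EL n
⊤ᴱ = ¬ᴱ (atomᴱ 0 ∧ᴱ (¬ᴱ atomᴱ 0))

⊤ᴱ-true : {n : ℕ} (N : SubModel n) (s : SubModel.S N) → satEL n N ⊤ᴱ s
⊤ᴱ-true N s (p , ¬p) = ¬p p

module _ {n : ℕ} (M : Model n) where
  open Model M

  on : (S → Set) → SubModel n
  on D = record { M = M ; D = D }

  _≐_ : (S → Set) → (S → Set) → Set
  D ≐ D' = ∀ t → D t ⇔ D' t

  restrict-cong : {D D' P Q : S → Set} → D ≐ D' → P ≐ Q →
                  (λ t → D t × P t) ≐ (λ t → D' t × Q t)
  restrict-cong D≐D' P≐Q t = D≐D' t ×-⇔ P≐Q t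

  restrict-valid : {D P : S → Set} → (∀ t → D t → P t) → D ≐ (λ t → D t × P t)
  restrict-valid D⊆P t = mk⇔ (λ d → d , D⊆P t d) proj₁

  □-cong : {D D' A B : S → Set} (i : Fin n) (s : S) → D ≐ D' → A ≐ B →
           (∀ t → D t → R i s t → A t) ⇔ (∀ t → D' t → R i s t → B t)
  □-cong i s D≐D' A≐B = Π-cong-⇔ λ t → →-cong-⇔ (D≐D' t) (→-cong-⇔ (⇔-id _) (A≐B t))

  satEL-cong : {D D' : S → Set} → D ≐ D' → (ψ : EL n) →
               (λ s → satEL n (on D) ψ s) ≐ (λ s → satEL n (on D') ψ s)
  satEL-cong D≐D' (atomᴱ p) s = ⇔-id _
  satEL-cong D≐D' (¬ᴱ ψ) s = ¬-cong-⇔ (satEL-cong D≐D' ψ s)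
  satEL-cong D≐D' (ψ ∧ᴱ χ) s = satEL-cong D≐D' ψ s ×-⇔ satEL-cong D≐D' χ s
  satEL-cong D≐D' (Kᴱ i ψ) s = □-cong i s D≐D' (satEL-cong D≐D' ψ)

  sat-cong : {D D' : S → Set} → D ≐ D' → (φ : LUT n) →
             (λ s → sat n (on D) φ s) ≐ (λ s → sat n (on D') φ s)
  sat-cong D≐D' (atom p) s = ⇔-id _
  sat-cong D≐D' (¬' φ) s = ¬-cong-⇔ (sat-cong D≐D' φ s)
  sat-cong D≐D' (φ ∧' χ) s = sat-cong D≐D' φ s ×-⇔ sat-cong D≐D' χ s
  sat-cong D≐D' (K i φ) s = □-cong i s D≐D' (sat-cong D≐D' φ)
  sat-cong D≐D' ([ ψ ] φ) s =
    →-cong-⇔ (sat-cong D≐D' ψ s) (sat-cong (restrict-cong D≐D' (sat-cong D≐D' ψ)) φ s)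
  sat-cong D≐D' (U i φ) s =
    sat-cong D≐D' φ s ×-⇔ Π-cong-⇔ λ ψ →
      let after-ψ = restrict-cong D≐D' (satEL-cong D≐D' ψ) in
      →-cong-⇔ (satEL-cong D≐D' ψ s) (¬-cong-⇔ (□-cong i s after-ψ (sat-cong after-ψ φ)))

U⇒¬K : {n : ℕ} (N : SubModel n) (i : Fin n) (φ : LUT n) (s : SubModel.S N) →
       sat n N (U i φ) s → ¬ sat n N (K i φ) s
U⇒¬K N i φ s (_ , ¬K-after) Kφ =
  ¬K-after ⊤ᴱ (⊤ᴱ-true N s)
    (to (sat-cong M (restrict-valid M (λ t _ → ⊤ᴱ-true N t)) (K i φ) s) Kφ)
  where open SubModel N using (M)

mainTheorem6 : (n : ℕ) (i : Fin n) (φ : LUT n) → ⊨_ n (¬'_ (K i (U i φ)))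
mainTheorem6 n i φ M s KUφ =
  U⇒¬K N i φ s (KUφ s tt (R-refl i s)) (λ t d r → proj₁ (KUφ t d r))
  where
  open Model M using (R-refl)
  N : SubModel n
  N = record { M = M ; D = λ _ → ⊤ }
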